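{- If $G_1,\ldots,G_r$, $r\ge 1$, are uniform geodesic graphs, then the Cartesian product $G_1 \,\square\, \cdots \,\square\, G_r$ is also a uniform geodesic graph.
   Context: Graphs are finite, simple and connected; ${\rm diam}(G)$ is the diameter. A geodesic is a shortest path; it is maximal if it is not contained as a subpath in any other geodesic. A graph $G$ is uniform geodesic if every maximal geodesic in $G$ has length ${\rm diam}(G)$. The Cartesian product $G\,\square\,H$ has vertex set $V(G)\times V(H)$, with $(g,h)$ adjacent to $(g',h')$ iff either $g=g'$ and $hh'\in E(H)$, or $h=h'$ and $gg'\in E(G)$. -}

module Defs where

open import Data.Nat using (ℕ; zero; suc; _≤_; _∸_)
open import Data.Fin using (Fin; zero; suc)
open import Data.List using (List; []; _∷_; [_]; _++_; length; cartesianProduct)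
open import Data.List.Membership.Propositional using (_∈_)
open import Data.List.Membership.Propositional.Properties using (∈-cartesianProduct⁺)
open import Data.Product using (Σ; ∃; ∃-syntax; _×_; _,_)
open import Data.Sum using (_⊎_; inj₁; inj₂)
open import Data.Empty using (⊥)
open import Relation.Nullary using (¬_)
open import Relation.Binary.PropositionalEquality using (_≡_)

record Graph : Set₁ where
  field
    V        : Set
    Adj      : V → V → Set
    sym      : ∀ {u v} → Adj u v → Adj v u
    irrefl   : ∀ {v} → ¬ Adj v v
    vertices : List V
    complete : ∀ v → v ∈ vertices
    vertex   : V
open Graph public

module _ (G : Graph) where
  data WalkL : V G → V G → List (V G) → Set where
    single : ∀ v → WalkL v v [ v ]
    cons   : ∀ {u w v ws} → Adj G u w → WalkL w v ws → WalkL u v (u ∷ ws)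

  -- a walk of length k (k edges) from u to v
  Walk : V G → V G → ℕ → Set
  Walk u v k = ∃[ P ] (WalkL u v P × length P ≡ suc k)

  Connected : Set
  Connected = ∀ u v → ∃[ k ] Walk u v k

  Dist : V G → V G → ℕ → Set
  Dist u v d = Walk u v d × (∀ k → Walk u v k → d ≤ k)

  IsDiameter : ℕ → Set
  IsDiameter D = (∃[ u ] ∃[ v ] Dist u v D) × (∀ u v d → Dist u v d → d ≤ D)

  len : List (V G) → ℕ
  len P = length P ∸ 1

  Geodesic : List (V G) → Set
  Geodesic P = ∃[ u ] ∃[ v ] (WalkL u v P × Dist u v (len P))

  SubpathOf : List (V G) → List (V G) → Set
  SubpathOf P Q = ∃[ A ] ∃[ B ] (Q ≡ A ++ P ++ B)

  MaximalGeodesic : List (V G) → Set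
  MaximalGeodesic P = Geodesic P × (∀ Q → Geodesic Q → SubpathOf P Q → Q ≡ P)

  UniformGeodesic : Set
  UniformGeodesic = ∀ P → MaximalGeodesic P → IsDiameter (len P)

data ProdAdj (G H : Graph) : V G × V H → V G × V H → Set where
  left  : ∀ {g g' h} → Adj G g g' → ProdAdj G H (g , h) (g' , h)
  right : ∀ {g h h'} → Adj H h h' → ProdAdj G H (g , h) (g , h')

_□_ : Graph → Graph → Graph
G □ H = record
  { V        = V G × V H
  ; Adj      = ProdAdj G H
  ; sym      = λ { (left a) → left (sym G a) ; (right a) → right (sym H a) }
  ; irrefl   = λ { (left a) → irrefl G a ; (right a) → irrefl H a }
  ; vertices = cartesianProduct (vertices G) (vertices H)
  ; complete = λ { (g , h) → ∈-cartesianProduct⁺ (complete G g) (complete H h) }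
  ; vertex   = vertex G , vertex H
  }

-- G₀ □ G₁ □ ⋯ □ Gₖ  (r = k + 1 ≥ 1 factors)
□-prod : (k : ℕ) → (Fin (suc k) → Graph) → Graph
□-prod zero    Gs = Gs zero
□-prod (suc k) Gs = Gs zero □ □-prod k (λ i → Gs (suc i))

-- Shortest walks in G □ H are exactly pairs of shortest walks in the factors,
-- so distances, and hence diameters, add.  A geodesic P of G □ H projects to
-- geodesics P₁, P₂ of the factors.  If P₁ were not maximal, the geodesic
-- extending it could be lifted into the G-fibres through the two ends of P and
-- glued to P, giving a geodesic of G □ H strictly containing P.  So the
-- projections of a maximal geodesic are maximal, of lengths diam G and diam H,
-- and P has length diam G + diam H = diam (G □ H).
module Submission where

open import Defs hiding (sym)
open import Data.Nat using (ℕ; zero; suc; _+_; _≤_; _∸_)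
open import Data.Nat.Properties
  using (+-suc; suc-injective; +-comm; +-mono-≤; +-cancelˡ-≤; +-cancelʳ-≤; m≤m+n; m≤n+m; ≤-trans; 1+n≰n; m+1+n≢m)
open import Data.Nat.Tactic.RingSolver using (solve-∀)
open import Data.Fin using (Fin; zero; suc)
open import Data.List using (List; []; _∷_; [_]; _++_; length; map)
open import Data.List.Properties using (++-assoc; ++-identityʳ; length-++; length-map; map-++)
open import Data.Product using (∃-syntax; _×_; _,_; proj₁; proj₂; map₁)
open import Data.Empty using (⊥-elim)
open import Relation.Binary.Core using (_=[_]⇒_)
open import Relation.Binary.PropositionalEquality using (_≡_; refl; sym; trans; cong; cong₂; subst; module ≡-Reasoning)

length-sandwich : ∀ {X : Set} (A P B : List X) → length (A ++ P ++ B) ≡ length A + (length P + length B)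
length-sandwich A P B = trans (length-++ A) (cong (length A +_) (length-++ P))

sandwich-empty : ∀ {X : Set} (A P B : List X) → length (A ++ P ++ B) ≡ length P → A ≡ [] × B ≡ []
sandwich-empty []      P []      _  = refl , refl
sandwich-empty []      P (_ ∷ B) eq = ⊥-elim (m+1+n≢m (length P) (trans (sym (length-++ P)) eq))
sandwich-empty (_ ∷ A) P B       eq = ⊥-elim (1+n≰n (subst (_≤ length (A ++ P ++ B)) (sym eq) P≤))
  where
  P≤ : length P ≤ length (A ++ P ++ B)
  P≤ = subst (length P ≤_) (sym (length-sandwich A P B))
         (≤-trans (m≤m+n (length P) (length B)) (m≤n+m _ (length A)))

map-≡[] : ∀ {X Y : Set} (f : X → Y) {A : List X} → map f A ≡ [] → A ≡ []
map-≡[] f {[]} _ = refl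

map-walk : ∀ {F K : Graph} {f : V F → V K} → Adj F =[ f ]⇒ Adj K →
           ∀ {x y L} → WalkL F x y L → WalkL K (f x) (f y) (map f L)
map-walk hom (single _) = single _
map-walk hom (cons a w) = cons (hom a) (map-walk hom w)

module _ (G : Graph) where

  length-walk : ∀ {x y L} → WalkL G x y L → length L ≡ suc (len G L)
  length-walk (single _) = refl
  length-walk (cons _ _) = refl

  toWalk : ∀ {x y L} → WalkL G x y L → Walk G x y (len G L)
  toWalk w = _ , w , length-walk w

  walk-head : ∀ {x y L} → WalkL G x y L → ∃[ R ] L ≡ x ∷ R
  walk-head (single _) = [] , refl
  walk-head (cons _ _) = _ , refl

  walk-last : ∀ {x y L} → WalkL G x y L → ∃[ R ] L ≡ R ++ [ y ]
  walk-last (single _) = [] , refl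
  walk-last (cons {u = u} _ w) with walk-last w
  ... | R , refl = u ∷ R , refl

  len-sandwich : ∀ A B {u v L} → WalkL G u v L → len G (A ++ L ++ B) ≡ length A + (len G L + length B)
  len-sandwich A B {L = L} w = begin
    length (A ++ L ++ B) ∸ 1                  ≡⟨ cong (_∸ 1) (length-sandwich A L B) ⟩
    length A + (length L + length B) ∸ 1      ≡⟨ cong (λ n → length A + (n + length B) ∸ 1) (length-walk w) ⟩
    length A + suc (len G L + length B) ∸ 1   ≡⟨ cong (_∸ 1) (+-suc (length A) _) ⟩
    length A + (len G L + length B)           ∎
    where open ≡-Reasoning

  join : ∀ {x c y L C} → WalkL G x c L → WalkL G c y (c ∷ C) → WalkL G x y (L ++ C)
  join (single _) w' = w'
  join (cons a w) w' = cons a (join w w')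

  split-walk : ∀ {x y c} A {C} → WalkL G x y (A ++ c ∷ C) → WalkL G x c (A ++ [ c ]) × WalkL G c y (c ∷ C)
  split-walk []               (single _) = single _ , single _
  split-walk []               (cons a w) = single _ , cons a w
  split-walk (_ ∷ [])         (cons a w) = map₁ (cons a) (split-walk [] w)
  split-walk (_ ∷ A@(_ ∷ _)) (cons a w) = map₁ (cons a) (split-walk A w)

  trim : ∀ A B {x y u v L} → WalkL G x y (A ++ L ++ B) → WalkL G u v L →
         WalkL G x u (A ++ [ u ]) × WalkL G v y (v ∷ B)
  trim A B w wL = prefix (walk-head wL) , suffix (walk-last wL)
    where
    prefix : ∀ {u} → ∃[ R ] _ ≡ u ∷ R → WalkL G _ u (A ++ [ u ])
    prefix (R , refl) = proj₁ (split-walk A w)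
    suffix : ∀ {v} → ∃[ S ] _ ≡ S ++ [ v ] → WalkL G v _ (v ∷ B)
    suffix {v} (S , refl) = proj₂ (split-walk (A ++ S) (subst (WalkL G _ _) reassoc w))
      where
      reassoc : A ++ (S ++ [ v ]) ++ B ≡ (A ++ S) ++ v ∷ B
      reassoc = trans (cong (A ++_) (++-assoc S [ v ] B)) (sym (++-assoc A S (v ∷ B)))

  splice : ∀ A {B x u v y P} → WalkL G x u (A ++ [ u ]) → WalkL G u v P → WalkL G v y (v ∷ B) →
           WalkL G x y (A ++ P ++ B)
  splice []               (single _) wP suf = join wP suf
  splice []               (cons _ ())
  splice (_ ∷ [])         (cons a w) wP suf = cons a (splice [] w wP suf)
  splice (_ ∷ A@(_ ∷ _)) (cons a w) wP suf = cons a (splice A w wP suf)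

module _ {F K : Graph} {f f' : V F → V K} (hom : Adj F =[ f ]⇒ Adj K) (hom' : Adj F =[ f' ]⇒ Adj K)
         (c : ℕ) (dist-shift : ∀ {x y d} → Dist F x y d → Dist K (f x) (f' y) (d + c)) where

  -- f and f' embed F as the fibres through the two ends of P, and c is the distance travelled
  -- in the other factor; a geodesic A ++ L ++ B of F is rerouted as map f A ++ P ++ map f' B.
  projection-maximal : ∀ {g g' L P} → WalkL F g g' L → WalkL K (f g) (f' g') P → MaximalGeodesic K P →
                       len K P ≡ len F L + c → ∀ Q → Geodesic F Q → SubpathOf F L Q → Q ≡ L
  projection-maximal {g} {L = L} {P} wL wP (_ , maxP) lenP _ (x , y , wQ , dQ) (A , B , refl) =
    begin
      A ++ L ++ B   ≡⟨ cong₂ (λ A B → A ++ L ++ B) (map-≡[] f (proj₁ trivial)) (map-≡[] f' (proj₂ trivial)) ⟩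
      L ++ []       ≡⟨ ++-identityʳ L ⟩
      L             ∎
    where
    open ≡-Reasoning
    ends = trim F A B wQ wL
    detour : WalkL K (f x) (f' y) (map f A ++ P ++ map f' B)
    detour = splice K (map f A) (subst (WalkL K _ _) (map-++ f A [ g ]) (map-walk hom (proj₁ ends)))
                      wP (map-walk hom' (proj₂ ends))
    interchange : ∀ a l b c → a + (l + b) + c ≡ a + ((l + c) + b)
    interchange = solve-∀
    len-detour : len F (A ++ L ++ B) + c ≡ len K (map f A ++ P ++ map f' B)
    len-detour = begin
      len F (A ++ L ++ B) + c                        ≡⟨ cong (_+ c) (len-sandwich F A B wL) ⟩
      length A + (len F L + length B) + c            ≡⟨ interchange (length A) (len F L) (length B) c ⟩
      length A + ((len F L + c) + length B)          ≡⟨ cong (λ n → length A + (n + length B)) (sym lenP) ⟩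
      length A + (len K P + length B)                ≡⟨ sym (cong₂ (λ a b → a + (len K P + b)) (length-map f A) (length-map f' B)) ⟩
      length (map f A) + (len K P + length (map f' B)) ≡⟨ sym (len-sandwich K (map f A) (map f' B) wP) ⟩
      len K (map f A ++ P ++ map f' B)               ∎
    detour≡P : map f A ++ P ++ map f' B ≡ P
    detour≡P = maxP _ (_ , _ , detour , subst (Dist K _ _) len-detour (dist-shift dQ)) (map f A , map f' B , refl)
    trivial : map f A ≡ [] × map f' B ≡ []
    trivial = sandwich-empty (map f A) P (map f' B) (cong length detour≡P)

module _ (G H : Graph) where

  project : ∀ {g h g' h' P} → WalkL (G □ H) (g , h) (g' , h') P →
            ∃[ L₁ ] ∃[ L₂ ] WalkL G g g' L₁ × WalkL H h h' L₂ × len G L₁ + len H L₂ ≡ len (G □ H) P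
  project (single _) = [ _ ] , [ _ ] , single _ , single _ , refl
  project (cons {u = g , _} (left a) w) with project w
  ... | L₁ , L₂ , w₁ , w₂ , eq = g ∷ L₁ , L₂ , cons a w₁ , w₂ ,
    trans (cong (_+ len H L₂) (length-walk G w₁)) (trans (cong suc eq) (sym (length-walk (G □ H) w)))
  project (cons {u = _ , h} (right a) w) with project w
  ... | L₁ , L₂ , w₁ , w₂ , eq = L₁ , h ∷ L₂ , w₁ , cons a w₂ ,
    trans (cong (len G L₁ +_) (length-walk H w₂))
      (trans (+-suc (len G L₁) (len H L₂)) (trans (cong suc eq) (sym (length-walk (G □ H) w))))

  pair-walk : ∀ {g g' h h' k₁ k₂} → Walk G g g' k₁ → Walk H h h' k₂ → Walk (G □ H) (g , h) (g' , h') (k₁ + k₂)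
  pair-walk {g' = g'} {h} (L₁ , w₁ , e₁) (L₂ , w₂ , e₂) with walk-head H w₂
  ... | R , refl = map (_, h) L₁ ++ map (g' ,_) R ,
    join (G □ H) (map-walk left w₁) (map-walk right w₂) ,
    trans (length-++ (map (_, h) L₁))
      (cong₂ _+_ (trans (length-map _ L₁) e₁) (trans (length-map _ R) (suc-injective e₂)))

  unpair-walk : ∀ {g g' h h' k} → Walk (G □ H) (g , h) (g' , h') k →
                ∃[ k₁ ] ∃[ k₂ ] Walk G g g' k₁ × Walk H h h' k₂ × k₁ + k₂ ≡ k
  unpair-walk (_ , w , e) with project w
  ... | _ , _ , w₁ , w₂ , eq = _ , _ , toWalk G w₁ , toWalk H w₂ , trans eq (cong (_∸ 1) e)

  dist-□ : ∀ {g g' h h' a b} → Dist G g g' a → Dist H h h' b → Dist (G □ H) (g , h) (g' , h') (a + b)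
  dist-□ (wa , minA) (wb , minB) = pair-walk wa wb , shortest
    where
    shortest : ∀ k → Walk (G □ H) _ _ k → _ ≤ k
    shortest k wk with unpair-walk wk
    ... | k₁ , k₂ , w₁ , w₂ , refl = +-mono-≤ (minA k₁ w₁) (minB k₂ w₂)

  dist-factors : ∀ {g g' h h' k₁ k₂} → Dist (G □ H) (g , h) (g' , h') (k₁ + k₂) →
                 Walk G g g' k₁ → Walk H h h' k₂ → Dist G g g' k₁ × Dist H h h' k₂
  dist-factors {k₁ = k₁} {k₂} (_ , min) w₁ w₂ =
    (w₁ , λ k w → +-cancelʳ-≤ k₂ k₁ k (min (k + k₂) (pair-walk w w₂))) ,
    (w₂ , λ k w → +-cancelˡ-≤ k₁ k₂ k (min (k₁ + k) (pair-walk w₁ w)))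

  diameter-□ : ∀ {a b} → IsDiameter G a → IsDiameter H b → IsDiameter (G □ H) (a + b)
  diameter-□ ((u , u' , du) , boundG) ((v , v' , dv) , boundH) = ((u , v) , (u' , v') , dist-□ du dv) , bound
    where
    bound : ∀ x y d → Dist (G □ H) x y d → d ≤ _
    bound (g , h) (g' , h') d dd with unpair-walk (proj₁ dd)
    ... | k₁ , k₂ , w₁ , w₂ , refl with dist-factors dd w₁ w₂
    ... | d₁ , d₂ = +-mono-≤ (boundG _ _ _ d₁) (boundH _ _ _ d₂)

  connected-□ : Connected G → Connected H → Connected (G □ H)
  connected-□ cG cH (g , h) (g' , h') with cG g g' | cH h h'
  ... | _ , w₁ | _ , w₂ = _ , pair-walk w₁ w₂

  uniformGeodesic-□ : UniformGeodesic G → UniformGeodesic H → UniformGeodesic (G □ H)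
  uniformGeodesic-□ uG uH P maxP@(((g , h) , (g' , h') , w , dP) , _) with project w
  ... | L₁ , L₂ , w₁ , w₂ , eq =
    subst (IsDiameter (G □ H)) eq (diameter-□ (uG L₁ (geodesic₁ , maximal₁)) (uH L₂ (geodesic₂ , maximal₂)))
    where
    dists = dist-factors (subst (Dist (G □ H) _ _) (sym eq) dP) (toWalk G w₁) (toWalk H w₂)
    geodesic₁ : Geodesic G L₁
    geodesic₁ = g , g' , w₁ , proj₁ dists
    geodesic₂ : Geodesic H L₂
    geodesic₂ = h , h' , w₂ , proj₂ dists
    maximal₁ : ∀ Q → Geodesic G Q → SubpathOf G L₁ Q → Q ≡ L₁
    maximal₁ = projection-maximal left left (len H L₂) (λ d → dist-□ d (proj₂ dists)) w₁ w maxP (sym eq)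
    maximal₂ : ∀ Q → Geodesic H Q → SubpathOf H L₂ Q → Q ≡ L₂
    maximal₂ = projection-maximal right right (len G L₁)
      (λ {_} {_} {d} dist → subst (Dist (G □ H) _ _) (+-comm (len G L₁) d) (dist-□ (proj₁ dists) dist))
      w₂ w maxP (trans (sym eq) (+-comm (len G L₁) (len H L₂)))

proposition2p7 : (k : ℕ) (Gs : Fin (suc k) → Graph)
                 → (∀ i → Connected (Gs i))
                 → (∀ i → UniformGeodesic (Gs i))
                 → Connected (□-prod k Gs) × UniformGeodesic (□-prod k Gs)
proposition2p7 zero    Gs conn unif = conn zero , unif zero
proposition2p7 (suc k) Gs conn unif with proposition2p7 k (λ i → Gs (suc i)) (λ i → conn (suc i)) (λ i → unif (suc i))
... | conn' , unif' = connected-□ (Gs zero) _ (conn zero) conn' , uniformGeodesic-□ (Gs zero) _ (unif zero) unif'
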